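{- Let $l,k\ge 2$ be integers and let $G_1,\ldots,G_l$ be connected $k$-symmetric graphs. Then the graph $G=\overline{K}_k\vee_k(G_1\cup\cdots\cup G_l)$ is 2-connected and prime with respect to the Cartesian product.
   Context: A finite simple graph $H$ is $k$-symmetric if $\mathrm{Aut}(H)$ contains a subgroup isomorphic to $\mathbb{Z}_k$ acting freely on $V(H)$; a generator $\varphi$ of such a subgroup is a $k$-symmetric automorphism, and a base of $\varphi$ is a subset $B\subseteq V(H)$ containing exactly one vertex from each $\langle\varphi\rangle$-orbit. The graph $G=\overline{K}_k\vee_k(G_1\cup\cdots\cup G_l)$ is defined as follows, for arbitrary choices of $k$-symmetric automorphisms $\varphi_i$ of $G_i$ and bases $B_i$ of $\varphi_i$: take the disjoint union of $G_1,\ldots,G_l$ together with $k$ new pairwise nonadjacent vertices $u_j$, $j\in\mathbb{Z}_k$, and for each $j\in\mathbb{Z}_k$ and each $i$ join $u_j$ to every vertex of $\varphi_i^j(B_i)$; no other edges are added. A graph is 2-connected if removing fewer than 2 vertices never leaves a disconnected or trivial graph. A graph is prime with respect to the Cartesian product if it is not isomorphic to a Cartesian product of two graphs each with at least two vertices. -}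

module Defs where

open import Data.Nat using (ℕ; zero; suc; _<_)
open import Data.Fin using (Fin; toℕ)
open import Data.Product using (Σ; ∃; _×_; _,_; proj₁; proj₂)
open import Data.Sum using (_⊎_; inj₁; inj₂)
open import Data.Empty using (⊥)
open import Function using (_∘_)
open import Function.Bundles using (_↔_; Inverse; _⇔_)
open import Relation.Nullary using (¬_)
open import Relation.Binary.PropositionalEquality using (_≡_; _≢_; refl; sym)

record Graph : Set₁ where
  field
    V      : Set
    E      : V → V → Set
    E-sym  : ∀ {u v} → E u v → E v u
    E-irr  : ∀ {v} → ¬ E v v
open Graph public

IsFinite : Graph → Set
IsFinite G = Σ ℕ λ n → V G ↔ Fin n

NonTrivial : Graph → Set
NonTrivial G = Σ (V G) λ u → Σ (V G) λ v → u ≢ v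

data Walk (G : Graph) : V G → V G → Set where
  here : ∀ {v} → Walk G v v
  step : ∀ {u w v} → E G u w → Walk G w v → Walk G u v

Connected : Graph → Set
Connected G = Σ (V G) (λ _ → V G) × (∀ u v → Walk G u v)

deleteVertex : (G : Graph) → V G → Graph
deleteVertex G w = record
  { V = Σ (V G) λ v → v ≢ w
  ; E = λ a b → E G (proj₁ a) (proj₁ b)
  ; E-sym = E-sym G
  ; E-irr = E-irr G
  }

TwoConnected : Graph → Set
TwoConnected G = (Connected G × NonTrivial G)
               × (∀ w → Connected (deleteVertex G w) × NonTrivial (deleteVertex G w))

_□_ : Graph → Graph → Graph
H₁ □ H₂ = record
  { V = V H₁ × V H₂
  ; E = λ p q → (proj₁ p ≡ proj₁ q × E H₂ (proj₂ p) (proj₂ q))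
              ⊎ (E H₁ (proj₁ p) (proj₁ q) × proj₂ p ≡ proj₂ q)
  ; E-sym = λ { (inj₁ (e , x)) → inj₁ (sym e , E-sym H₂ x)
              ; (inj₂ (x , e)) → inj₂ (E-sym H₁ x , sym e) }
  ; E-irr = λ { (inj₁ (_ , x)) → E-irr H₂ x
              ; (inj₂ (x , _)) → E-irr H₁ x }
  }

_≅_ : Graph → Graph → Set
G ≅ H = Σ (V G ↔ V H) λ f →
          ∀ u v → E G u v ⇔ E H (Inverse.to f u) (Inverse.to f v)

CartesianPrime : Graph → Set₁
CartesianPrime G = ¬ (Σ Graph λ H₁ → Σ Graph λ H₂ →
                        NonTrivial H₁ × NonTrivial H₂ × (G ≅ (H₁ □ H₂)))

record Aut (G : Graph) : Set where
  field
    perm     : V G ↔ V G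
    preserve : ∀ u v → E G u v ⇔ E G (Inverse.to perm u) (Inverse.to perm v)
open Aut public

iter : {A : Set} → (A → A) → ℕ → A → A
iter f zero    = λ x → x
iter f (suc j) = f ∘ iter f j

pow : {G : Graph} → Aut G → ℕ → V G → V G
pow φ j = iter (Inverse.to (perm φ)) j

-- φ generates a subgroup ≅ ℤ_k acting freely:
-- φ^k = id and φ^j has no fixed vertex for 0 < j < k
-- (for nonempty V this forces ⟨φ⟩ to have order exactly k)
KSymmetricAut : (k : ℕ) (G : Graph) → Aut G → Set
KSymmetricAut k G φ = (∀ v → pow φ k v ≡ v)
                    × (∀ j → 0 < j → j < k → ∀ v → pow φ j v ≢ v)

IsBase : (k : ℕ) (G : Graph) → Aut G → (V G → Set) → Set
IsBase k G φ B = (∀ v → Σ (V G) λ b → B b × Σ ℕ λ j → pow φ j b ≡ v)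
               × (∀ b b' j → B b → B b' → pow φ j b ≡ b' → b ≡ b')

module _ (k l : ℕ) (G : Fin l → Graph) (φ : ∀ i → Aut (G i))
         (B : ∀ i → V (G i) → Set) where

  UnionV : Set
  UnionV = Σ (Fin l) λ i → V (G i)

  data UnionE : UnionV → UnionV → Set where
    inside : ∀ {i x y} → E (G i) x y → UnionE (i , x) (i , y)

  -- u_j ~ x  iff  x ∈ φ_i^j (B_i)
  HubE : Fin k → UnionV → Set
  HubE j (i , x) = Σ (V (G i)) λ b → B i b × pow (φ i) (toℕ j) b ≡ x

  JoinE : Fin k ⊎ UnionV → Fin k ⊎ UnionV → Set
  JoinE (inj₁ _) (inj₁ _) = ⊥
  JoinE (inj₁ j) (inj₂ x) = HubE j x
  JoinE (inj₂ x) (inj₁ j) = HubE j x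
  JoinE (inj₂ x) (inj₂ y) = UnionE x y

  JoinE-sym : ∀ {a b} → JoinE a b → JoinE b a
  JoinE-sym {inj₁ _} {inj₂ _} e = e
  JoinE-sym {inj₂ _} {inj₁ _} e = e
  JoinE-sym {inj₂ _} {inj₂ _} (inside e) = inside (E-sym (G _) e)

  JoinE-irr : ∀ {a} → ¬ JoinE a a
  JoinE-irr {inj₁ _} ()
  JoinE-irr {inj₂ _} (inside e) = E-irr (G _) e

  HubJoin : Graph
  HubJoin = record
    { V = Fin k ⊎ UnionV
    ; E = JoinE
    ; E-sym = JoinE-sym
    ; E-irr = JoinE-irr
    }

-- A vertex x of G_i has exactly one hub neighbour: the u_j with x ∈ φ_i^j(B_i), j < k, which
-- is unique because B_i meets each orbit once and ⟨φ_i⟩ acts freely.  Conversely every hub has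
-- a neighbour in every component.  Hence deleting a hub leaves every component attached to the
-- remaining hubs, and deleting a vertex of G_i leaves all hubs joined through another component.
--
-- For primality, colour each edge of G ≅ H₁ □ H₂ by the factor it moves in.  A vertex meeting
-- both colours spans a square, so such "mixed" vertices spread along edges; in a connected graph
-- without them every edge has the colour of any one edge, and the other factor is trivial.  A
-- hub is never mixed: a square through u_j closes either at a second hub (impossible by
-- uniqueness of hub neighbours) or inside one component, so all neighbours of u_j of one colour
-- share a component with all those of the other colour, although u_j sees two components.
module Submission where

open import Defs
open import Data.Nat using (ℕ; zero; suc; _≤_; _<_; _+_; _*_; _∸_; z≤n; s≤s; NonZero; >-nonZero)
open import Data.Nat.Properties using (<-cmp; m∸n+n≡m; <⇒≤; m<n⇒0<n∸m; ≤-trans; m∸n≤m; ≤-<-trans)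
open import Data.Nat.DivMod using (_%_; _/_; m≡m%n+[m/n]*n; m%n<n)
open import Data.Fin using (Fin; toℕ; fromℕ<; punchIn) renaming (zero to fzero)
open import Data.Fin.Properties using (toℕ<n; toℕ-injective; toℕ-fromℕ<; punchInᵢ≢i) renaming (_≟_ to _≟ᶠ_)
open import Data.Product using (Σ; _×_; _,_; proj₁; proj₂)
open import Data.Sum using (_⊎_; inj₁; inj₂; [_,_]; swap)
open import Data.Sum.Properties using (inj₁-injective; inj₂-injective)
open import Data.Empty using (⊥; ⊥-elim)
open import Function using (_∘_; id)
open import Function.Bundles using (Inverse; Equivalence)
open import Relation.Nullary using (¬_; Dec; yes; no)
open import Relation.Nullary.Decidable using (map′)
open import Relation.Binary.PropositionalEquality using (_≡_; _≢_; refl; sym; trans; cong; subst; subst₂; module ≡-Reasoning)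
open import Relation.Binary.Definitions using (tri<; tri≈; tri>)

fin-other : ∀ {n} → 2 ≤ n → (i : Fin n) → Σ (Fin n) (_≢ i)
fin-other (s≤s (s≤s _)) i = punchIn i fzero , punchInᵢ≢i i fzero

module _ {H : Graph} where

  walk-trans : ∀ {a b c} → Walk H a b → Walk H b c → Walk H a c
  walk-trans here       q = q
  walk-trans (step e p) q = step e (walk-trans p q)

  walk-sym : ∀ {a b} → Walk H a b → Walk H b a
  walk-sym here       = here
  walk-sym (step e p) = walk-trans (walk-sym p) (step (E-sym H e) here)

  walk-respects : {A : Set} (R : V H → V H → Set) (f : V H → A) →
                  (∀ {x y} → R x y → R y x) →
                  (∀ {x y z} → R x y → E H x z → R x z) →
                  (∀ {x y} → R x y → f x ≡ f y) →
                  ∀ {x y z} → R x y → Walk H x z → f x ≡ f z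
  walk-respects R f R-sym R-spreads f-resp r here       = refl
  walk-respects R f R-sym R-spreads f-resp r (step e p) =
    trans (f-resp r′) (walk-respects R f R-sym R-spreads f-resp (R-sym r′) p)
    where r′ = R-spreads r e

walk-map : {H H′ : Graph} (f : V H → V H′) → (∀ {x y} → E H x y → E H′ (f x) (f y)) →
           ∀ {x y} → Walk H x y → Walk H′ (f x) (f y)
walk-map f f-hom here       = here
walk-map f f-hom (step e p) = step (f-hom e) (walk-map f f-hom p)

root-reachable⇒connected : (H : Graph) (r : V H) → (∀ u → Walk H u r) → Connected H
root-reachable⇒connected H r to-r = (r , r) , λ u v → walk-trans (to-r u) (walk-sym (to-r v))

module Deletion (H : Graph) (w : V H) where

  H-w : Graph
  H-w = deleteVertex H w

  -- A vertex of H - w carries a proof that it differs from w; with no function extensionality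
  -- two such proofs need not be equal, so reachability quantifies over the starting proof.
  Reaches : V H → V H-w → Set
  Reaches u t = (p : u ≢ w) → Walk H-w (u , p) t

  reaches-adjacent : ∀ {u v} {q : v ≢ w} → E H u v → Reaches u (v , q)
  reaches-adjacent e p = step e here

  reaches-step : ∀ {u v t} → E H u v → v ≢ w → Reaches v t → Reaches u t
  reaches-step e q r p = step e (r q)

  reaches-along : {H′ : Graph} (f : V H′ → V H) → (∀ {x y} → E H′ x y → E H (f x) (f y)) →
                  (∀ x → f x ≢ w) → ∀ {x y t} → Walk H′ x y → Reaches (f y) t → Reaches (f x) t
  reaches-along f f-hom avoids here       r = r
  reaches-along f f-hom avoids (step e p) r =
    reaches-step (f-hom e) (avoids _) (reaches-along f f-hom avoids p r)

  deletion-connected⇒connected : (∀ u → Dec (u ≡ w)) → Connected H-w →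
                                 ∀ {n} → E H w n → Connected H
  deletion-connected⇒connected _≟w conn {n} e = root-reachable⇒connected H n to-n
    where
    n≢w : n ≢ w
    n≢w refl = E-irr H e

    to-n : ∀ u → Walk H u n
    to-n u with u ≟w
    ... | yes refl = step e here
    ... | no  u≢w  = walk-map proj₁ id (proj₂ conn (u , u≢w) (n , n≢w))

module Factorisation (G H₁ H₂ : Graph) (iso : G ≅ (H₁ □ H₂)) where

  π : V G → V H₁ × V H₂
  π = Inverse.to (proj₁ iso)

  π⁻¹ : V H₁ × V H₂ → V G
  π⁻¹ = Inverse.from (proj₁ iso)

  π∘π⁻¹ : ∀ p → π (π⁻¹ p) ≡ p
  π∘π⁻¹ p = Inverse.inverseˡ (proj₁ iso) refl

  π₁ : V G → V H₁
  π₁ = proj₁ ∘ π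

  π₂ : V G → V H₂
  π₂ = proj₂ ∘ π

  E₁ E₂ : V G → V G → Set
  E₁ x y = E H₁ (π₁ x) (π₁ y) × π₂ x ≡ π₂ y
  E₂ x y = π₁ x ≡ π₁ y × E H₂ (π₂ x) (π₂ y)

  E⇒E₁⊎E₂ : ∀ {x y} → E G x y → E₁ x y ⊎ E₂ x y
  E⇒E₁⊎E₂ {x} {y} = swap ∘ Equivalence.to (proj₂ iso x y)

  E₁⇒E : ∀ {x y} → E₁ x y → E G x y
  E₁⇒E {x} {y} = Equivalence.from (proj₂ iso x y) ∘ inj₂

  E₂⇒E : ∀ {x y} → E₂ x y → E G x y
  E₂⇒E {x} {y} = Equivalence.from (proj₂ iso x y) ∘ inj₁

  E₁-sym : ∀ {x y} → E₁ x y → E₁ y x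
  E₁-sym (e , eq) = E-sym H₁ e , sym eq

  E₂-sym : ∀ {x y} → E₂ x y → E₂ y x
  E₂-sym (eq , e) = sym eq , E-sym H₂ e

  E₁-E₂-disjoint : ∀ {x y} → E₁ x y → E₂ x y → ⊥
  E₁-E₂-disjoint {x} (e , _) (eq , _) = E-irr H₁ (subst (E H₁ (π₁ x)) (sym eq) e)

  square : ∀ {v a b} → E₁ v a → E₂ v b → Σ (V G) λ w → E₂ a w × E₁ b w
  square {v} {a} {b} (e₁ , eq₂) (eq₁ , e₂) =
    w , (sym (cong proj₁ πw) , subst₂ (E H₂) eq₂ (sym (cong proj₂ πw)) e₂)
      , (subst₂ (E H₁) eq₁ (sym (cong proj₁ πw)) e₁ , sym (cong proj₂ πw))
    where
    w = π⁻¹ (π₁ a , π₂ b)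
    πw = π∘π⁻¹ (π₁ a , π₂ b)

  Mixed : V G → Set
  Mixed v = Σ (V G) λ a → Σ (V G) λ b → E₁ v a × E₂ v b

  mixed-adjacent : ∀ {v u} → Mixed v → E G v u → Mixed u
  mixed-adjacent (a , b , e₁ , e₂) e with E⇒E₁⊎E₂ e
  ... | inj₁ e₁′ = let (w , e₂′ , _) = square e₁′ e₂ in _ , w , E₁-sym e₁′ , e₂′
  ... | inj₂ e₂′ = let (w , _ , e₁′) = square e₁ e₂′ in w , _ , e₁′ , E₂-sym e₂′

  module _ (unmixed : ∀ v → ¬ Mixed v) (conn : Connected G) where

    E₁-spreads : ∀ {x y z} → E₁ x y → E G x z → E₁ x z
    E₁-spreads e₁ e = [ id , (λ e₂ → ⊥-elim (unmixed _ (_ , _ , e₁ , e₂))) ] (E⇒E₁⊎E₂ e)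

    E₂-spreads : ∀ {x y z} → E₂ x y → E G x z → E₂ x z
    E₂-spreads e₂ e = [ (λ e₁ → ⊥-elim (unmixed _ (_ , _ , e₁ , e₂))) , id ] (E⇒E₁⊎E₂ e)

    E₁-collapses-H₂ : ∀ {x y} → E₁ x y → ∀ h → π₂ x ≡ h
    E₁-collapses-H₂ {x} e₁ h =
      trans (walk-respects E₁ π₂ E₁-sym E₁-spreads proj₂ e₁ (proj₂ conn x (π⁻¹ (π₁ x , h))))
            (cong proj₂ (π∘π⁻¹ _))

    E₂-collapses-H₁ : ∀ {x y} → E₂ x y → ∀ g → π₁ x ≡ g
    E₂-collapses-H₁ {x} e₂ g =
      trans (walk-respects E₂ π₁ E₂-sym E₂-spreads proj₁ e₂ (proj₂ conn x (π⁻¹ (g , π₂ x))))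
            (cong proj₁ (π∘π⁻¹ _))

    unmixed⇒trivial-factor : ∀ {x y} → E G x y → NonTrivial H₁ → NonTrivial H₂ → ⊥
    unmixed⇒trivial-factor e (g , g′ , g≢g′) (h , h′ , h≢h′) with E⇒E₁⊎E₂ e
    ... | inj₁ e₁ = h≢h′ (trans (sym (E₁-collapses-H₂ e₁ h)) (E₁-collapses-H₂ e₁ h′))
    ... | inj₂ e₂ = g≢g′ (trans (sym (E₂-collapses-H₁ e₂ g)) (E₂-collapses-H₁ e₂ g′))

unmixed⇒prime : (G : Graph) → Connected G → ∀ {x y} → E G x y →
                (∀ H₁ H₂ (iso : G ≅ (H₁ □ H₂)) v → ¬ Factorisation.Mixed G H₁ H₂ iso v) →
                CartesianPrime G
unmixed⇒prime G conn e unmixed (H₁ , H₂ , nt₁ , nt₂ , iso) =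
  Factorisation.unmixed⇒trivial-factor G H₁ H₂ iso (unmixed H₁ H₂ iso) conn e nt₁ nt₂

pow-+ : ∀ {H : Graph} (φ : Aut H) m n v → pow φ (m + n) v ≡ pow φ m (pow φ n v)
pow-+ φ zero    n v = refl
pow-+ φ (suc m) n v = cong (Inverse.to (perm φ)) (pow-+ φ m n v)

module Orbits {H : Graph} (k : ℕ) {{_ : NonZero k}} (φ : Aut H) (ksym : KSymmetricAut k H φ) where
  open ≡-Reasoning

  pow-multiple : ∀ q v → pow φ (q * k) v ≡ v
  pow-multiple zero    v = refl
  pow-multiple (suc q) v = begin
    pow φ (k + q * k) v      ≡⟨ pow-+ φ k (q * k) v ⟩
    pow φ k (pow φ (q * k) v) ≡⟨ cong (pow φ k) (pow-multiple q v) ⟩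
    pow φ k v                 ≡⟨ proj₁ ksym v ⟩
    v                         ∎

  pow-mod : ∀ m v → pow φ (m % k) v ≡ pow φ m v
  pow-mod m v = begin
    pow φ (m % k) v                         ≡⟨ cong (pow φ (m % k)) (sym (pow-multiple (m / k) v)) ⟩
    pow φ (m % k) (pow φ ((m / k) * k) v)   ≡⟨ sym (pow-+ φ (m % k) ((m / k) * k) v) ⟩
    pow φ (m % k + (m / k) * k) v           ≡⟨ cong (λ t → pow φ t v) (sym (m≡m%n+[m/n]*n m k)) ⟩
    pow φ m v                               ∎

  pow-separates : ∀ {a c v} → a < c → c < k → pow φ a v ≢ pow φ c v
  pow-separates {a} {c} {v} a<c c<k eq =
    proj₂ ksym (c ∸ a) (m<n⇒0<n∸m a<c) (≤-<-trans (m∸n≤m c a) c<k) (pow φ a v) (begin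
      pow φ (c ∸ a) (pow φ a v) ≡⟨ sym (pow-+ φ (c ∸ a) a v) ⟩
      pow φ (c ∸ a + a) v       ≡⟨ cong (λ t → pow φ t v) (m∸n+n≡m (<⇒≤ a<c)) ⟩
      pow φ c v                 ≡⟨ sym eq ⟩
      pow φ a v                 ∎)

  pow-injective : ∀ {a c v} → a < k → c < k → pow φ a v ≡ pow φ c v → a ≡ c
  pow-injective {a} {c} a<k c<k eq with <-cmp a c
  ... | tri< a<c _ _ = ⊥-elim (pow-separates a<c c<k eq)
  ... | tri≈ _ a≡c _ = a≡c
  ... | tri> _ _ c<a = ⊥-elim (pow-separates c<a a<k (sym eq))

  module _ {B : V H → Set} (base : IsBase k H φ B) where

    base-exponent : ∀ v → Σ (Fin k) λ j → Σ (V H) λ b → B b × pow φ (toℕ j) b ≡ v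
    base-exponent v =
      let (b , b∈B , m , eq) = proj₁ base v
          m%k<k = m%n<n m k
      in fromℕ< m%k<k , b , b∈B ,
         trans (cong (λ t → pow φ t b) (toℕ-fromℕ< m%k<k)) (trans (pow-mod m b) eq)

    base-exponent-unique : ∀ {b b′} (j j′ : Fin k) → B b → B b′ →
                           pow φ (toℕ j) b ≡ pow φ (toℕ j′) b′ → j ≡ j′
    base-exponent-unique {b} {b′} j j′ b∈B b′∈B eq =
      toℕ-injective (pow-injective (toℕ<n j) (toℕ<n j′) (trans eq (cong (pow φ (toℕ j′)) (sym b≡b′))))
      where
      b≡b′ : b ≡ b′
      b≡b′ = proj₂ base b b′ (k ∸ toℕ j′ + toℕ j) b∈B b′∈B (begin
        pow φ (k ∸ toℕ j′ + toℕ j) b          ≡⟨ pow-+ φ (k ∸ toℕ j′) (toℕ j) b ⟩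
        pow φ (k ∸ toℕ j′) (pow φ (toℕ j) b)  ≡⟨ cong (pow φ (k ∸ toℕ j′)) eq ⟩
        pow φ (k ∸ toℕ j′) (pow φ (toℕ j′) b′) ≡⟨ sym (pow-+ φ (k ∸ toℕ j′) (toℕ j′) b′) ⟩
        pow φ (k ∸ toℕ j′ + toℕ j′) b′        ≡⟨ cong (λ t → pow φ t b′) (m∸n+n≡m (<⇒≤ (toℕ<n j′))) ⟩
        pow φ k b′                           ≡⟨ proj₁ ksym b′ ⟩
        b′                                   ∎)

pattern hub j = inj₁ j
pattern vertex i x = inj₂ (i , x)

module HubJoinProperties (l k : ℕ) (2≤l : 2 ≤ l) (2≤k : 2 ≤ k)
    (G : Fin l → Graph) (conn : ∀ i → Connected (G i))
    (φ : ∀ i → Aut (G i)) (ksym : ∀ i → KSymmetricAut k (G i) (φ i))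
    (B : ∀ i → V (G i) → Set) (base : ∀ i → IsBase k (G i) (φ i) (B i)) where

  𝔾 : Graph
  𝔾 = HubJoin k l G φ B

  0<k : 0 < k
  0<k = ≤-trans (s≤s z≤n) 2≤k

  instance
    k-nonZero : NonZero k
    k-nonZero = >-nonZero 0<k

  i₀ : Fin l
  i₀ = fromℕ< (≤-trans (s≤s z≤n) 2≤l)

  j₀ : Fin k
  j₀ = fromℕ< 0<k

  hub-of : ∀ i x → Σ (Fin k) λ j → E 𝔾 (vertex i x) (hub j)
  hub-of i = Orbits.base-exponent k (φ i) (ksym i) (base i)

  hub-unique : ∀ {i x j j′} → E 𝔾 (hub j) (vertex i x) → E 𝔾 (hub j′) (vertex i x) → j ≡ j′
  hub-unique {i} {j = j} {j′} (b , b∈B , eq) (b′ , b′∈B , eq′) =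
    Orbits.base-exponent-unique k (φ i) (ksym i) (base i) j j′ b∈B b′∈B (trans eq (sym eq′))

  hub-neighbour : ∀ j i → Σ (V (G i)) λ x → E 𝔾 (hub j) (vertex i x)
  hub-neighbour j i =
    let (_ , b , b∈B , _) = hub-of i (proj₁ (proj₁ (conn i)))
    in pow (φ i) (toℕ j) b , b , b∈B , refl

  same-component : ∀ {i x i′ y} → E 𝔾 (vertex i x) (vertex i′ y) → i ≡ i′
  same-component (inside _) = refl

  _≟hub_ : ∀ (u : V 𝔾) j → Dec (u ≡ hub j)
  hub j′     ≟hub j = map′ (cong inj₁) inj₁-injective (j′ ≟ᶠ j)
  vertex _ _ ≟hub j = no λ ()

  module _ (w : V 𝔾) where
    open Deletion 𝔾 w

    hubs-linked : ∀ i → (∀ x → vertex i x ≢ w) → ∀ j {r} (q : hub r ≢ w) → Reaches (hub j) (hub r , q)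
    hubs-linked i avoids j {r} q =
      reaches-step (proj₂ (hub-neighbour j i)) (avoids _)
        (reaches-along (vertex i) inside avoids (proj₂ (conn i) _ _)
          (reaches-adjacent (proj₂ (hub-neighbour r i))))

    deletion-connected : ∀ i → (∀ x → vertex i x ≢ w) → ∀ r (q : hub r ≢ w) →
                         (∀ i′ x → Reaches (vertex i′ x) (hub r , q)) → Connected H-w
    deletion-connected i avoids r q vertices-reach = root-reachable⇒connected H-w (hub r , q) λ where
      (hub j , p)        → hubs-linked i avoids j q p
      (vertex i′ x , p)  → vertices-reach i′ x p

  hub-deletion-connected : ∀ j → Connected (deleteVertex 𝔾 (hub j))
  hub-deletion-connected j = deletion-connected (hub j) i₀ (λ _ ()) r (r≢j ∘ inj₁-injective)
    λ i x → reaches-along (vertex i) inside (λ _ ())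
              (proj₂ (conn i) x (proj₁ (hub-neighbour r i)))
              (reaches-adjacent (proj₂ (hub-neighbour r i)))
    where
    open Deletion 𝔾 (hub j)
    r = proj₁ (fin-other 2≤k j)
    r≢j = proj₂ (fin-other 2≤k j)

  vertex-deletion-connected : ∀ i x → Connected (deleteVertex 𝔾 (vertex i x))
  vertex-deletion-connected i x = deletion-connected (vertex i x) i′ avoids j₀ (λ ())
    λ i″ y → let (h , e) = hub-of i″ y in
      reaches-step {v = hub h} e (λ ()) (hubs-linked (vertex i x) i′ avoids h (λ ()))
    where
    open Deletion 𝔾 (vertex i x)
    i′ = proj₁ (fin-other 2≤l i)
    avoids : ∀ y → vertex i′ y ≢ vertex i x
    avoids y = proj₂ (fin-other 2≤l i) ∘ cong proj₁ ∘ inj₂-injective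

  x₀ : V (G i₀)
  x₀ = proj₁ (hub-neighbour j₀ i₀)

  connected : Connected 𝔾
  connected = Deletion.deletion-connected⇒connected 𝔾 (hub j₀) (_≟hub j₀)
                (hub-deletion-connected j₀) {vertex i₀ x₀} (proj₂ (hub-neighbour j₀ i₀))

  two-connected : TwoConnected 𝔾
  two-connected = (connected , distinct-hubs) , λ where
      (hub j)      → hub-deletion-connected j , distinct-vertices j
      (vertex i x) → vertex-deletion-connected i x , distinct-remaining-hubs i x
    where
    j₁ = proj₁ (fin-other 2≤k j₀)
    j₁≢j₀ = proj₂ (fin-other 2≤k j₀)

    distinct-hubs : NonTrivial 𝔾
    distinct-hubs = hub j₁ , hub j₀ , j₁≢j₀ ∘ inj₁-injective

    distinct-remaining-hubs : ∀ i x → NonTrivial (deleteVertex 𝔾 (vertex i x))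
    distinct-remaining-hubs i x = (hub j₁ , λ ()) , (hub j₀ , λ ()) , j₁≢j₀ ∘ inj₁-injective ∘ cong proj₁

    distinct-vertices : ∀ j → NonTrivial (deleteVertex 𝔾 (hub j))
    distinct-vertices j =
      let (i₁ , i₁≢i₀) = fin-other 2≤l i₀ in
      (vertex i₁ (proj₁ (hub-neighbour j i₁)) , λ ()) , (vertex i₀ (proj₁ (hub-neighbour j i₀)) , λ ()) ,
      i₁≢i₀ ∘ cong proj₁ ∘ inj₂-injective ∘ cong proj₁

  module _ (H₁ H₂ : Graph) (iso : 𝔾 ≅ (H₁ □ H₂)) where
    open Factorisation 𝔾 H₁ H₂ iso

    hub-square : ∀ {j i x i′ y} → E₁ (hub j) (vertex i x) → E₂ (hub j) (vertex i′ y) → i ≡ i′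
    hub-square {j} {i} {x} e₁ e₂ with square e₁ e₂
    ... | hub j′ , e₂′ , e₁′ with hub-unique {i} {x} {j} {j′} (E₁⇒E e₁) (E₂⇒E e₂′)
    ...   | refl = ⊥-elim (E₁-E₂-disjoint (E₁-sym e₁′) e₂)
    hub-square e₁ e₂ | vertex _ _ , e₂′ , e₁′ =
      trans (same-component (E₂⇒E e₂′)) (sym (same-component (E₁⇒E e₁′)))

    hub-unmixed : ∀ j → ¬ Mixed (hub j)
    hub-unmixed j (hub _ , _ , e₁ , _) = E₁⇒E e₁
    hub-unmixed j (_ , hub _ , _ , e₂) = E₂⇒E e₂
    hub-unmixed j (vertex i x , vertex i′ y , e₁ , e₂) =
      [ (λ e₁′ → c≢i (trans (hub-square e₁′ e₂) (sym (hub-square e₁ e₂))))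
      , (λ e₂′ → c≢i (sym (hub-square e₁ e₂′)))
      ] (E⇒E₁⊎E₂ (proj₂ (hub-neighbour j c)))
      where
      c = proj₁ (fin-other 2≤l i)
      c≢i = proj₂ (fin-other 2≤l i)

    unmixed : ∀ v → ¬ Mixed v
    unmixed (hub j)      = hub-unmixed j
    unmixed (vertex i x) m = let (j , e) = hub-of i x in hub-unmixed j (mixed-adjacent {u = hub j} m e)

  cartesian-prime : CartesianPrime 𝔾
  cartesian-prime = unmixed⇒prime 𝔾 connected {hub j₀} {vertex i₀ x₀} (proj₂ (hub-neighbour j₀ i₀)) unmixed

theorem4p6 : (l k : ℕ) → 2 ≤ l → 2 ≤ k →
    (G : Fin l → Graph) → (∀ i → IsFinite (G i)) → (∀ i → Connected (G i)) →
    (φ : ∀ i → Aut (G i)) → (∀ i → KSymmetricAut k (G i) (φ i)) →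
    (B : ∀ i → V (G i) → Set) → (∀ i → IsBase k (G i) (φ i) (B i)) →
    TwoConnected (HubJoin k l G φ B) × CartesianPrime (HubJoin k l G φ B)
theorem4p6 l k 2≤l 2≤k G _ conn φ ksym B base = two-connected , cartesian-prime
  where open HubJoinProperties l k 2≤l 2≤k G conn φ ksym B base
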